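{- Let $a,b$ be coprime positive integers. Then the Markov polynomial $M_{a/b}(x,y,z)$ has the form $$M_{a/b}(x,y,z)=\frac{P_{a/b}(x^2,y^2,z^2)}{x^{a-1}\,y^{b-1}\,z^{a+b-1}},$$ where $P_{a/b}(u,v,w)$ is a homogeneous polynomial of degree $a+b-1$ with non-negative integer coefficients which is not divisible by $u$, by $v$ or by $w$.
   Context: Markov polynomials $M_\rho(x,y,z)\in\mathbb{Z}[x^{\pm1},y^{\pm1},z^{\pm1}]$, indexed by $\rho\in\mathbb{Q}_{\ge0}\cup\{1/0\}$, are defined recursively by $M_{0/1}=x$, $M_{1/0}=y$, $M_{1/1}=(x^2+y^2)/z$, and the rule: whenever $p/q$ and $r/s$ are fractions in lowest terms with $p,q,r,s\ge0$ and $qr-ps=1$, with mediant $\mu=(p+r)/(q+s)$, then $M_{(2p+r)/(2q+s)}=(M_{p/q}^2+M_{\mu}^2)/M_{r/s}$ and $M_{(p+2r)/(q+2s)}=(M_{\mu}^2+M_{r/s}^2)/M_{p/q}$. (Equivalently: starting from the triple $(x,y,z)$ one applies the Vieta involutions $(X,Y,Z)\mapsto(X,Y,(X^2+Y^2)/Z)$ of the equation $X^2+Y^2+Z^2=\frac{x^2+y^2+z^2}{xyz}XYZ$ along the Conway topograph labelled by Farey fractions; for $\rho>1$ one has $M_\rho(x,y,z)=M_{1/\rho}(y,x,z)$.) For instance $M_{1/2}=((x^2+y^2)^2+x^2z^2)/(yz^2)$. -}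

module Defs where

open import Data.Nat as ℕ using (ℕ; zero; suc; _∸_)
open import Data.Bool using (Bool; true; false)
open import Data.List using (List; []; _∷_; foldr)
open import Data.List.Relation.Unary.All using (All)
open import Data.List.Relation.Unary.Any using (Any)
open import Data.Product using (_×_; _,_)
open import Relation.Nullary using (yes; no; ¬_)
open import Relation.Binary.PropositionalEquality using (_≡_; _≢_)
open import Data.Integer using (+_)
open import Data.Rational using (ℚ; 0ℚ; 1ℚ; _+_; _*_; _÷_; _/_)
open import Data.Rational.Properties using (_≟_)
open import Data.Rational.Base using (≢-nonZero)

_^ℚ_ : ℚ → ℕ → ℚ
q ^ℚ zero    = 1ℚ
q ^ℚ (suc n) = q * (q ^ℚ n)

ℕ→ℚ : ℕ → ℚ
ℕ→ℚ n = (+ n) / 1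

-- total division: p ⊘ q = p / q when q ≠ 0 (and 0 otherwise; this case
-- never occurs below since all values are evaluated at positive x,y,z)
_⊘_ : ℚ → ℚ → ℚ
p ⊘ q with q ≟ 0ℚ
... | yes _  = 0ℚ
... | no q≢0 = _÷_ p q {{≢-nonZero q≢0}}

sq : ℚ → ℚ
sq t = t * t

-- Markov polynomials, evaluated at (x,y,z), via the Stern–Brocot tree
-- (Farey/Conway topograph).
--
-- A node of the tree is described by its left bound p/q, its right
-- bound r/s (qr - ps = 1) and their mediant; we carry the values
-- (M_{p/q}, M_mediant, M_{r/s}).  Going left the new node is
-- (p/q , (2p+r)/(2q+s) , mediant) with new mediant value
-- (M_{p/q}^2 + M_mediant^2)/M_{r/s}; going right the new node is
-- (mediant , (p+2r)/(q+2s) , r/s) with new mediant value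
-- (M_mediant^2 + M_{r/s}^2)/M_{p/q}.

record Node : Set where
  constructor node
  field
    left mid right : ℚ

step : Bool → Node → Node
-- false = go left, true = go right
step false (node L C R) = node L ((sq L + sq C) ⊘ R) C
step true  (node L C R) = node C ((sq C + sq R) ⊘ L) R

-- root: bounds 0/1 (value x) and 1/0 (value y), mediant 1/1
-- (value (x^2+y^2)/z)
root : ℚ → ℚ → ℚ → Node
root x y z = node x ((sq x + sq y) ⊘ z) y

descend : List Bool → Node → Node
descend []       n = n
descend (d ∷ ds) n = descend ds (step d n)

-- Stern–Brocot path of a/b (for coprime positive a, b), computed by the
-- subtractive Euclidean algorithm with fuel:
--   a < b : L then path of a/(b-a);  a > b : R then path of (a-b)/b;
--   a = b : empty path (the node 1/1).
sbPath : ℕ → ℕ → ℕ → List Bool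
sbPath zero     a b = []
sbPath (suc f)  a b with ℕ.compare a b
... | ℕ.less    _ k = false ∷ sbPath f a (suc k)
... | ℕ.equal   _   = []
... | ℕ.greater _ k = true  ∷ sbPath f (suc k) b

-- M_{a/b}(x,y,z) for coprime positive a, b (fuel a+b suffices).
M : ℕ → ℕ → ℚ → ℚ → ℚ → ℚ
M a b x y z = Node.mid (descend (sbPath (a ℕ.+ b) a b) (root x y z))

record Term : Set where
  constructor term
  field
    coeff : ℕ
    eu ev ew : ℕ

Poly : Set
Poly = List Term

evalTerm : Term → ℚ → ℚ → ℚ → ℚ
evalTerm (term c i j k) u v w = ℕ→ℚ c * ((u ^ℚ i) * ((v ^ℚ j) * (w ^ℚ k)))

evalPoly : Poly → ℚ → ℚ → ℚ → ℚ
evalPoly P u v w = foldr (λ t acc → evalTerm t u v w + acc) 0ℚ P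

Homogeneous : ℕ → Poly → Set
Homogeneous d P = All (λ t → Term.eu t ℕ.+ Term.ev t ℕ.+ Term.ew t ≡ d) P

-- Since all coefficients are non-negative there is no cancellation, so
-- P is not divisible by u iff some term with non-zero coefficient has
-- u-exponent 0 (similarly for v, w).
NotDivU : Poly → Set
NotDivU P = Any (λ t → Term.coeff t ≢ 0 × Term.eu t ≡ 0) P

NotDivV : Poly → Set
NotDivV P = Any (λ t → Term.coeff t ≢ 0 × Term.ev t ≡ 0) P

NotDivW : Poly → Set
NotDivW P = Any (λ t → Term.coeff t ≢ 0 × Term.ew t ≡ 0) P

{-# OPTIONS --safe #-}
-- Following Cohn, give the Farey fraction p/q the scale s = x^p y^q z^(p+q) and a 2×2
-- matrix E of polynomials in u = x², v = y², w = z² with non-negative coefficients: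
-- E = [[u+w, uv], [1, v]] for 0/1, E = [[u, uv], [1, v+w]] for 1/0, and E_left E_right for
-- the mediant of two Stern–Brocot neighbours.  With t = xyz and σ = x² + y² + z² one keeps,
-- down the Stern–Brocot tree, the invariants  M s = t E₂₁,  tr E = σ E₂₁,  det E = s²
-- together with the Markov-type equation t(l² + c² + r²) = σ l c r for each node (l, c, r).
-- That equation turns the Vieta flip (l² + c²)/r into the linear expression σ l c / t − r,
-- and Cayley–Hamilton gives the same linear recursion for E₂₁ of the new product, so no
-- polynomial division is ever needed.  P is E₂₁ for a/b: every entry (i, j) of a matrix of
-- weight p + q is homogeneous of degree p + q + j − i, and the pattern "u divides no entry of
-- the second row, v none of the first column, w none but E₁₂" is preserved by products.
module Submission where

open import Defs
open import Data.Bool using (Bool; true; false)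
open import Data.List using (List; []; _∷_)
open import Data.Product using (_×_; _,_; proj₁; proj₂; uncurry)
open import Data.Product.Relation.Binary.Pointwise.NonDependent using (Pointwise)
open import Relation.Binary.PropositionalEquality
open ≡-Reasoning
open import Level using (0ℓ)
open import Data.Rational using (ℚ; 0ℚ; Positive)
open import Data.Rational.Properties using (+-*-commutativeRing; _≟_)
open import Relation.Nullary.Decidable using (dec⇒maybe)
open import Tactic.RingSolver.Core.AlmostCommutativeRing using (AlmostCommutativeRing; fromCommutativeRing)

ℚ-ring : AlmostCommutativeRing 0ℓ 0ℓ
ℚ-ring = fromCommutativeRing +-*-commutativeRing (λ q → dec⇒maybe (0ℚ ≟ q))

module SternBrocot where
  open import Data.Nat
  open import Data.Nat.Properties using (+-suc; +-monoˡ-≤; +-monoʳ-≤; ≤-trans; ≤-pred; ≤-refl)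
  open import Data.Nat.Divisibility using (∣m∣n⇒∣m+n; ∣-refl)
  open import Data.Nat.Coprimality as Coprimality using (Coprime)
  open import Data.Nat.Tactic.RingSolver using (solve)

  stepPair : {A : Set} → (A → A → A) → Bool → A × A → A × A
  stepPair _∙_ false (l , r) = l , l ∙ r
  stepPair _∙_ true  (l , r) = l ∙ r , r

  descendPair : {A : Set} → (A → A → A) → List Bool → A × A → A × A
  descendPair _∙_ []       p = p
  descendPair _∙_ (d ∷ ds) p = descendPair _∙_ ds (stepPair _∙_ d p)

  mediant : {A : Set} → (A → A → A) → List Bool → A × A → A
  mediant _∙_ ds p = uncurry _∙_ (descendPair _∙_ ds p)

  module _ {A B : Set} (_∙_ : A → A → A) (_∘_ : B → B → B) (_∼_ : A → B → Set)
           (∙-∘-compatible : ∀ {a a′ b b′} → a ∼ b → a′ ∼ b′ → (a ∙ a′) ∼ (b ∘ b′)) where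

    stepPair-pointwise : ∀ d {p q} → Pointwise _∼_ _∼_ p q →
                         Pointwise _∼_ _∼_ (stepPair _∙_ d p) (stepPair _∘_ d q)
    stepPair-pointwise false (l∼ , r∼) = l∼ , ∙-∘-compatible l∼ r∼
    stepPair-pointwise true  (l∼ , r∼) = ∙-∘-compatible l∼ r∼ , r∼

    descendPair-pointwise : ∀ ds {p q} → Pointwise _∼_ _∼_ p q →
                            Pointwise _∼_ _∼_ (descendPair _∙_ ds p) (descendPair _∘_ ds q)
    descendPair-pointwise []       p∼q = p∼q
    descendPair-pointwise (d ∷ ds) p∼q = descendPair-pointwise ds (stepPair-pointwise d p∼q)

    mediant-related : ∀ ds {p q} → Pointwise _∼_ _∼_ p q → mediant _∙_ ds p ∼ mediant _∘_ ds q
    mediant-related ds p∼q = uncurry ∙-∘-compatible (descendPair-pointwise ds p∼q)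

  coprime-+⁻ : ∀ {m n} → Coprime m (m + n) → Coprime m n
  coprime-+⁻ coprime (d∣m , d∣n) = coprime (d∣m , ∣m∣n⇒∣m+n d∣m d∣n)

  coprime-suc-+⁻ : ∀ {m n} → Coprime m (suc (m + n)) → Coprime m (suc n)
  coprime-suc-+⁻ {m} {n} coprime = coprime-+⁻ (subst (Coprime m) (sym (+-suc m n)) coprime)

  sbPath-mediant-+ : ∀ f a b → 1 ≤ a → 1 ≤ b → Coprime a b → a + b ≤ f → ∀ l r →
                     mediant _+_ (sbPath f a b) (l , r) ≡ b * l + a * r
  sbPath-mediant-+ zero    _ _ (s≤s z≤n) _ _ () _ _
  sbPath-mediant-+ (suc f) a b 1≤a 1≤b coprime a+b≤1+f l r with compare a b
  ... | less a k = begin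
    mediant _+_ (sbPath f a (suc k)) (l , l + r)
      ≡⟨ sbPath-mediant-+ f a (suc k) 1≤a (s≤s z≤n) (coprime-suc-+⁻ coprime) a+1+k≤f l (l + r) ⟩
    suc k * l + a * (l + r)
      ≡⟨ solve (a ∷ k ∷ l ∷ r ∷ []) ⟩
    suc (a + k) * l + a * r ∎
    where
    a+1+k≤f : a + suc k ≤ f
    a+1+k≤f = ≤-trans (+-monoʳ-≤ a (+-monoˡ-≤ k 1≤a))
                      (≤-pred (subst (_≤ suc f) (+-suc a (a + k)) a+b≤1+f))
  ... | greater b k = begin
    mediant _+_ (sbPath f (suc k) b) (l + r , r)
      ≡⟨ sbPath-mediant-+ f (suc k) b (s≤s z≤n) 1≤b coprime′ 1+k+b≤f (l + r) r ⟩
    b * (l + r) + suc k * r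
      ≡⟨ solve (b ∷ k ∷ l ∷ r ∷ []) ⟩
    b * l + suc (b + k) * r ∎
    where
    1+k+b≤f : suc k + b ≤ f
    1+k+b≤f = ≤-trans (+-monoˡ-≤ b (+-monoˡ-≤ k 1≤b)) (≤-pred a+b≤1+f)
    coprime′ : Coprime (suc k) b
    coprime′ = Coprimality.sym (coprime-suc-+⁻ (Coprimality.sym coprime))
  ... | equal a with coprime {a} (∣-refl , ∣-refl)
  ...   | refl = solve (l ∷ r ∷ [])

  Fraction : Set
  Fraction = ℕ × ℕ

  _⊕_ : Fraction → Fraction → Fraction
  (p , q) ⊕ (r , s) = p + r , q + s

  sbPath-mediant-⊕ : ∀ {a b} → 1 ≤ a → 1 ≤ b → Coprime a b →
                     mediant _⊕_ (sbPath (a + b) a b) ((0 , 1) , (1 , 0)) ≡ (a , b)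
  sbPath-mediant-⊕ {a} {b} 1≤a 1≤b coprime = cong₂ _,_
    (begin
      proj₁ (mediant _⊕_ path ((0 , 1) , (1 , 0)))
        ≡⟨ mediant-related _⊕_ _+_ (λ f n → proj₁ f ≡ n) (cong₂ _+_) path {q = 0 , 1} (refl , refl) ⟩
      mediant _+_ path (0 , 1)
        ≡⟨ sbPath-mediant-+ (a + b) a b 1≤a 1≤b coprime ≤-refl 0 1 ⟩
      b * 0 + a * 1
        ≡⟨ solve (a ∷ b ∷ []) ⟩
      a ∎)
    (begin
      proj₂ (mediant _⊕_ path ((0 , 1) , (1 , 0)))
        ≡⟨ mediant-related _⊕_ _+_ (λ f n → proj₂ f ≡ n) (cong₂ _+_) path {q = 1 , 0} (refl , refl) ⟩
      mediant _+_ path (1 , 0)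
        ≡⟨ sbPath-mediant-+ (a + b) a b 1≤a 1≤b coprime ≤-refl 1 0 ⟩
      b * 1 + a * 0
        ≡⟨ solve (a ∷ b ∷ []) ⟩
      b ∎)
    where
    path = sbPath (a + b) a b

module Polynomial where
  open import Data.Nat as ℕ using (ℕ; zero; suc)
  open import Data.Nat.Properties using (m*n≡0⇒m≡0∨n≡0; m+n∸n≡m; +-identityʳ)
  open import Data.Nat.Tactic.RingSolver as ℕ-Solver using ()
  import Data.Integer as ℤ
  open import Data.Integer.Properties using (pos-*)
  open import Data.Rational using (0ℚ; 1ℚ; _+_; _*_; _/_)
  open import Data.Rational.Properties
    using (normalize-coprime; +-identityˡ; +-assoc; *-identityˡ; *-assoc; *-zeroˡ; *-zeroʳ; *-distribˡ-+; *-distribʳ-+)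
  open import Data.Nat.Coprimality using (1-coprimeTo) renaming (sym to coprime-sym)
  open import Data.List using (List; []; _∷_; _++_; map; cartesianProductWith)
  open import Data.List.Relation.Unary.All as All using (All)
  open import Data.List.Relation.Unary.Any using (Any)
  import Data.List.Relation.Unary.All.Properties as All
  import Data.List.Relation.Unary.Any.Properties as Any
  open import Data.Sum using ([_,_]′)
  open import Relation.Binary.PropositionalEquality.Properties using (setoid)
  open import Tactic.RingSolver using (solve-∀; solve)

  infixl 7 _·ₜ_ _*ₚ_

  _·ₜ_ : Term → Term → Term
  term c i j k ·ₜ term c′ i′ j′ k′ = term (c ℕ.* c′) (i ℕ.+ i′) (j ℕ.+ j′) (k ℕ.+ k′)

  _*ₚ_ : Poly → Poly → Poly
  _*ₚ_ = cartesianProductWith _·ₜ_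

  𝐮 𝐯 𝐰 𝟏 : Poly
  𝐮 = term 1 1 0 0 ∷ []
  𝐯 = term 1 0 1 0 ∷ []
  𝐰 = term 1 0 0 1 ∷ []
  𝟏 = term 1 0 0 0 ∷ []

  ℕ→ℚ-* : ∀ m n → ℕ→ℚ (m ℕ.* n) ≡ ℕ→ℚ m * ℕ→ℚ n
  ℕ→ℚ-* m n = begin
    ℕ→ℚ (m ℕ.* n)             ≡⟨ cong (_/ 1) (pos-* m n) ⟩
    (ℤ.+ m ℤ.* ℤ.+ n) / 1     ≡⟨ cong₂ _*_ (integral m) (integral n) ⟨
    ℕ→ℚ m * ℕ→ℚ n             ∎
    where
    integral : ∀ k → ℕ→ℚ k ≡ _
    integral k = normalize-coprime (coprime-sym (1-coprimeTo k))

  ^ℚ-+ : ∀ q m n → q ^ℚ (m ℕ.+ n) ≡ q ^ℚ m * q ^ℚ n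
  ^ℚ-+ q zero    n = sym (*-identityˡ (q ^ℚ n))
  ^ℚ-+ q (suc m) n = trans (cong (q *_) (^ℚ-+ q m n)) (sym (*-assoc q (q ^ℚ m) (q ^ℚ n)))

  module _ (u v w : ℚ) where

    evalTerm-·ₜ : ∀ t s → evalTerm (t ·ₜ s) u v w ≡ evalTerm t u v w * evalTerm s u v w
    evalTerm-·ₜ (term c i j k) (term c′ i′ j′ k′) = begin
      ℕ→ℚ (c ℕ.* c′) * (u ^ℚ (i ℕ.+ i′) * (v ^ℚ (j ℕ.+ j′) * w ^ℚ (k ℕ.+ k′)))
        ≡⟨ cong₂ _*_ (ℕ→ℚ-* c c′) (cong₂ _*_ (^ℚ-+ u i i′) (cong₂ _*_ (^ℚ-+ v j j′) (^ℚ-+ w k k′))) ⟩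
      ℕ→ℚ c * ℕ→ℚ c′ * (u ^ℚ i * u ^ℚ i′ * (v ^ℚ j * v ^ℚ j′ * (w ^ℚ k * w ^ℚ k′)))
        ≡⟨ separate (ℕ→ℚ c) (ℕ→ℚ c′) (u ^ℚ i) (u ^ℚ i′) (v ^ℚ j) (v ^ℚ j′) (w ^ℚ k) (w ^ℚ k′) ⟩
      evalTerm (term c i j k) u v w * evalTerm (term c′ i′ j′ k′) u v w ∎
      where
      separate : ∀ c c′ x x′ y y′ z z′ →
                 c * c′ * (x * x′ * (y * y′ * (z * z′))) ≡ c * (x * (y * z)) * (c′ * (x′ * (y′ * z′)))
      separate = solve-∀ ℚ-ring

    evalPoly-++ : ∀ P Q → evalPoly (P ++ Q) u v w ≡ evalPoly P u v w + evalPoly Q u v w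
    evalPoly-++ []      Q = sym (+-identityˡ (evalPoly Q u v w))
    evalPoly-++ (t ∷ P) Q = trans (cong (evalTerm t u v w +_) (evalPoly-++ P Q))
                                  (sym (+-assoc (evalTerm t u v w) (evalPoly P u v w) (evalPoly Q u v w)))

    evalPoly-map-·ₜ : ∀ t Q → evalPoly (map (t ·ₜ_) Q) u v w ≡ evalTerm t u v w * evalPoly Q u v w
    evalPoly-map-·ₜ t []      = sym (*-zeroʳ (evalTerm t u v w))
    evalPoly-map-·ₜ t (s ∷ Q) = trans (cong₂ _+_ (evalTerm-·ₜ t s) (evalPoly-map-·ₜ t Q))
                                      (sym (*-distribˡ-+ (evalTerm t u v w) (evalTerm s u v w) (evalPoly Q u v w)))

    evalPoly-*ₚ : ∀ P Q → evalPoly (P *ₚ Q) u v w ≡ evalPoly P u v w * evalPoly Q u v w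
    evalPoly-*ₚ []      Q = sym (*-zeroˡ (evalPoly Q u v w))
    evalPoly-*ₚ (t ∷ P) Q = begin
      evalPoly (map (t ·ₜ_) Q ++ P *ₚ Q) u v w
        ≡⟨ evalPoly-++ (map (t ·ₜ_) Q) (P *ₚ Q) ⟩
      evalPoly (map (t ·ₜ_) Q) u v w + evalPoly (P *ₚ Q) u v w
        ≡⟨ cong₂ _+_ (evalPoly-map-·ₜ t Q) (evalPoly-*ₚ P Q) ⟩
      evalTerm t u v w * evalPoly Q u v w + evalPoly P u v w * evalPoly Q u v w
        ≡⟨ *-distribʳ-+ (evalPoly Q u v w) (evalTerm t u v w) (evalPoly P u v w) ⟨
      evalPoly (t ∷ P) u v w * evalPoly Q u v w ∎

    evalPoly-𝐮 : evalPoly 𝐮 u v w ≡ u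
    evalPoly-𝐮 = begin
      evalPoly 𝐮 u v w                       ≡⟨⟩
      1ℚ * (u * 1ℚ * (1ℚ * 1ℚ)) + 0ℚ         ≡⟨ solve (u ∷ []) ℚ-ring ⟩
      u                                      ∎

    evalPoly-𝐯 : evalPoly 𝐯 u v w ≡ v
    evalPoly-𝐯 = begin
      evalPoly 𝐯 u v w                       ≡⟨⟩
      1ℚ * (1ℚ * (v * 1ℚ * 1ℚ)) + 0ℚ         ≡⟨ solve (v ∷ []) ℚ-ring ⟩
      v                                      ∎

    evalPoly-𝐰 : evalPoly 𝐰 u v w ≡ w
    evalPoly-𝐰 = begin
      evalPoly 𝐰 u v w                       ≡⟨⟩
      1ℚ * (1ℚ * (1ℚ * (w * 1ℚ))) + 0ℚ       ≡⟨ solve (w ∷ []) ℚ-ring ⟩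
      w                                      ∎

  degree : Term → ℕ
  degree t = Term.eu t ℕ.+ Term.ev t ℕ.+ Term.ew t

  -- homogeneous of degree n + j - i, written without truncated subtraction
  HomogeneousEntry : ℕ → ℕ → ℕ → Poly → Set
  HomogeneousEntry i j n = All (λ t → degree t ℕ.+ i ≡ n ℕ.+ j)

  HomogeneousEntry-*ₚ : ∀ {i j k m n P Q} → HomogeneousEntry i j m P → HomogeneousEntry j k n Q →
                        HomogeneousEntry i k (m ℕ.+ n) (P *ₚ Q)
  HomogeneousEntry-*ₚ {i} {j} {k} {m} {n} {P} {Q} homP homQ =
    All.cartesianProductWith⁺ (setoid Term) (setoid Term) _·ₜ_ P Q
      (λ {t} {s} t∈P s∈Q → degree-·ₜ t s (All.lookup homP t∈P) (All.lookup homQ s∈Q))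
    where
    degree-·ₜ : ∀ t s → degree t ℕ.+ i ≡ m ℕ.+ j → degree s ℕ.+ j ≡ n ℕ.+ k →
                degree (t ·ₜ s) ℕ.+ i ≡ (m ℕ.+ n) ℕ.+ k
    degree-·ₜ (term _ a b c) (term _ a′ b′ c′) t-hom s-hom = begin
      (a ℕ.+ a′) ℕ.+ (b ℕ.+ b′) ℕ.+ (c ℕ.+ c′) ℕ.+ i
        ≡⟨ ℕ-Solver.solve (a ∷ a′ ∷ b ∷ b′ ∷ c ∷ c′ ∷ i ∷ []) ⟩
      (a ℕ.+ b ℕ.+ c ℕ.+ i) ℕ.+ (a′ ℕ.+ b′ ℕ.+ c′)
        ≡⟨ cong (ℕ._+ (a′ ℕ.+ b′ ℕ.+ c′)) t-hom ⟩
      (m ℕ.+ j) ℕ.+ (a′ ℕ.+ b′ ℕ.+ c′)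
        ≡⟨ ℕ-Solver.solve (m ∷ j ∷ a′ ∷ b′ ∷ c′ ∷ []) ⟩
      m ℕ.+ (a′ ℕ.+ b′ ℕ.+ c′ ℕ.+ j)
        ≡⟨ cong (m ℕ.+_) s-hom ⟩
      m ℕ.+ (n ℕ.+ k)
        ≡⟨ ℕ-Solver.solve (m ∷ n ∷ k ∷ []) ⟩
      (m ℕ.+ n) ℕ.+ k ∎

  HomogeneousEntry⇒Homogeneous : ∀ {n P} → HomogeneousEntry 1 0 n P → Homogeneous (n ℕ.∸ 1) P
  HomogeneousEntry⇒Homogeneous {n} = All.map λ {t} degree+1≡n+0 → begin
    degree t                   ≡⟨ m+n∸n≡m (degree t) 1 ⟨
    degree t ℕ.+ 1 ℕ.∸ 1       ≡⟨ cong (ℕ._∸ 1) degree+1≡n+0 ⟩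
    n ℕ.+ 0 ℕ.∸ 1              ≡⟨ cong (ℕ._∸ 1) (+-identityʳ n) ⟩
    n ℕ.∸ 1                    ∎

  FreeOf : (Term → ℕ) → Term → Set
  FreeOf e t = Term.coeff t ≢ 0 × e t ≡ 0

  FreeOf-*ₚ : ∀ {e P Q} → (∀ t s → e (t ·ₜ s) ≡ e t ℕ.+ e s) →
              Any (FreeOf e) P → Any (FreeOf e) Q → Any (FreeOf e) (P *ₚ Q)
  FreeOf-*ₚ {e} e-· = Any.cartesianProductWith⁺ _·ₜ_ λ {t} {s} (c≢0 , et≡0) (c′≢0 , es≡0) →
    (λ cc′≡0 → [ c≢0 , c′≢0 ]′ (m*n≡0⇒m≡0∨n≡0 (Term.coeff t) cc′≡0)) ,
    trans (e-· t s) (cong₂ ℕ._+_ et≡0 es≡0)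

  NotDivU-*ₚ : ∀ {P Q} → NotDivU P → NotDivU Q → NotDivU (P *ₚ Q)
  NotDivU-*ₚ = FreeOf-*ₚ {Term.eu} λ _ _ → refl

  NotDivV-*ₚ : ∀ {P Q} → NotDivV P → NotDivV Q → NotDivV (P *ₚ Q)
  NotDivV-*ₚ = FreeOf-*ₚ {Term.ev} λ _ _ → refl

  NotDivW-*ₚ : ∀ {P Q} → NotDivW P → NotDivW Q → NotDivW (P *ₚ Q)
  NotDivW-*ₚ = FreeOf-*ₚ {Term.ew} λ _ _ → refl

module Matrix where
  open import Data.Rational using (_+_; _*_; _-_)
  open import Data.List using (_++_)
  import Data.List.Relation.Unary.All.Properties as All
  import Data.List.Relation.Unary.Any.Properties as Any
  open import Data.Nat as ℕ using (ℕ)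
  open import Tactic.RingSolver using (solve-∀)
  open Polynomial

  record Mat₂ (A : Set) : Set where
    constructor mat
    field m₁₁ m₁₂ m₂₁ m₂₂ : A

  open Mat₂ public

  mat-cong : ∀ {A : Set} {a a′ b b′ c c′ d d′ : A} →
             a ≡ a′ → b ≡ b′ → c ≡ c′ → d ≡ d′ → mat a b c d ≡ mat a′ b′ c′ d′
  mat-cong refl refl refl refl = refl

  map : ∀ {A B : Set} → (A → B) → Mat₂ A → Mat₂ B
  map f (mat a b c d) = mat (f a) (f b) (f c) (f d)

  mul : ∀ {A : Set} → (A → A → A) → (A → A → A) → Mat₂ A → Mat₂ A → Mat₂ A
  mul _⊞_ _⊠_ (mat a b c d) (mat a′ b′ c′ d′) =
    mat ((a ⊠ a′) ⊞ (b ⊠ c′)) ((a ⊠ b′) ⊞ (b ⊠ d′)) ((c ⊠ a′) ⊞ (d ⊠ c′)) ((c ⊠ b′) ⊞ (d ⊠ d′))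

  infixl 7 _*ₘ_ _*ₚₘ_

  _*ₘ_ : Mat₂ ℚ → Mat₂ ℚ → Mat₂ ℚ
  _*ₘ_ = mul _+_ _*_

  tr : Mat₂ ℚ → ℚ
  tr (mat a _ _ d) = a + d

  det : Mat₂ ℚ → ℚ
  det (mat a b c d) = a * d - b * c

  det-*ₘ : ∀ L R → det (L *ₘ R) ≡ det L * det R
  det-*ₘ (mat a b c d) (mat e f g h) = identity a b c d e f g h
    where
    identity : ∀ a b c d e f g h →
      (a * e + b * g) * (c * f + d * h) - (a * f + b * h) * (c * e + d * g) ≡ (a * d - b * c) * (e * h - f * g)
    identity = solve-∀ ℚ-ring

  m₂₁-cayley-hamiltonˡ : ∀ L R → m₂₁ (L *ₘ (L *ₘ R)) ≡ tr L * m₂₁ (L *ₘ R) - det L * m₂₁ R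
  m₂₁-cayley-hamiltonˡ (mat a b c d) (mat e _ g _) = identity a b c d e g
    where
    identity : ∀ a b c d e g →
      c * (a * e + b * g) + d * (c * e + d * g) ≡ (a + d) * (c * e + d * g) - (a * d - b * c) * g
    identity = solve-∀ ℚ-ring

  tr-cayley-hamiltonˡ : ∀ L R → tr (L *ₘ (L *ₘ R)) ≡ tr L * tr (L *ₘ R) - det L * tr R
  tr-cayley-hamiltonˡ (mat a b c d) (mat e f g h) = identity a b c d e f g h
    where
    identity : ∀ a b c d e f g h →
      a * (a * e + b * g) + b * (c * e + d * g) + (c * (a * f + b * h) + d * (c * f + d * h))
        ≡ (a + d) * (a * e + b * g + (c * f + d * h)) - (a * d - b * c) * (e + h)
    identity = solve-∀ ℚ-ring

  m₂₁-cayley-hamiltonʳ : ∀ L R → m₂₁ ((L *ₘ R) *ₘ R) ≡ tr R * m₂₁ (L *ₘ R) - det R * m₂₁ L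
  m₂₁-cayley-hamiltonʳ (mat _ _ c d) (mat e f g h) = identity c d e f g h
    where
    identity : ∀ c d e f g h →
      (c * e + d * g) * e + (c * f + d * h) * g ≡ (e + h) * (c * e + d * g) - (e * h - f * g) * c
    identity = solve-∀ ℚ-ring

  tr-cayley-hamiltonʳ : ∀ L R → tr ((L *ₘ R) *ₘ R) ≡ tr R * tr (L *ₘ R) - det R * tr L
  tr-cayley-hamiltonʳ (mat a b c d) (mat e f g h) = identity a b c d e f g h
    where
    identity : ∀ a b c d e f g h →
      (a * e + b * g) * e + (a * f + b * h) * g + ((c * e + d * g) * f + (c * f + d * h) * h)
        ≡ (e + h) * (a * e + b * g + (c * f + d * h)) - (e * h - f * g) * (a + d)
    identity = solve-∀ ℚ-ring

  _*ₚₘ_ : Mat₂ Poly → Mat₂ Poly → Mat₂ Poly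
  _*ₚₘ_ = mul _++_ _*ₚ_

  evalMat : ℚ → ℚ → ℚ → Mat₂ Poly → Mat₂ ℚ
  evalMat u v w = map (λ P → evalPoly P u v w)

  evalMat-*ₚₘ : ∀ u v w E F → evalMat u v w (E *ₚₘ F) ≡ evalMat u v w E *ₘ evalMat u v w F
  evalMat-*ₚₘ u v w (mat a b c d) (mat a′ b′ c′ d′) =
    mat-cong (evalPoly-dot a a′ b c′) (evalPoly-dot a b′ b d′) (evalPoly-dot c a′ d c′) (evalPoly-dot c b′ d d′)
    where
    evalPoly-dot : ∀ P Q R S → evalPoly (P *ₚ Q ++ R *ₚ S) u v w
                               ≡ evalPoly P u v w * evalPoly Q u v w + evalPoly R u v w * evalPoly S u v w
    evalPoly-dot P Q R S =
      trans (evalPoly-++ u v w (P *ₚ Q) (R *ₚ S)) (cong₂ _+_ (evalPoly-*ₚ u v w P Q) (evalPoly-*ₚ u v w R S))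

  HomogeneousMat : ℕ → Mat₂ Poly → Set
  HomogeneousMat n (mat a b c d) =
    HomogeneousEntry 0 0 n a × HomogeneousEntry 0 1 n b × HomogeneousEntry 1 0 n c × HomogeneousEntry 1 1 n d

  HomogeneousMat-*ₚₘ : ∀ {m n E F} → HomogeneousMat m E → HomogeneousMat n F →
                       HomogeneousMat (m ℕ.+ n) (E *ₚₘ F)
  HomogeneousMat-*ₚₘ (a , b , c , d) (a′ , b′ , c′ , d′) =
    All.++⁺ (HomogeneousEntry-*ₚ a a′) (HomogeneousEntry-*ₚ b c′) ,
    All.++⁺ (HomogeneousEntry-*ₚ a b′) (HomogeneousEntry-*ₚ b d′) ,
    All.++⁺ (HomogeneousEntry-*ₚ c a′) (HomogeneousEntry-*ₚ d c′) ,
    All.++⁺ (HomogeneousEntry-*ₚ c b′) (HomogeneousEntry-*ₚ d d′)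

  Indivisible : Mat₂ Poly → Set
  Indivisible (mat a b c d) = (NotDivU c × NotDivU d) × (NotDivV a × NotDivV c) × (NotDivW a × NotDivW c × NotDivW d)

  Indivisible-*ₚₘ : ∀ {E F} → Indivisible E → Indivisible F → Indivisible (E *ₚₘ F)
  Indivisible-*ₚₘ {mat a b c d} {mat a′ b′ c′ d′}
    ((cU , dU) , (aV , cV) , (aW , cW , dW)) ((c′U , d′U) , (a′V , c′V) , (a′W , c′W , d′W)) =
    (Any.++⁺ʳ (c *ₚ a′) (NotDivU-*ₚ dU c′U) , Any.++⁺ʳ (c *ₚ b′) (NotDivU-*ₚ dU d′U)) ,
    (Any.++⁺ˡ (NotDivV-*ₚ aV a′V) , Any.++⁺ˡ (NotDivV-*ₚ cV a′V)) ,
    (Any.++⁺ˡ (NotDivW-*ₚ aW a′W) , Any.++⁺ˡ (NotDivW-*ₚ cW a′W) ,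
     Any.++⁺ʳ (c *ₚ b′) (NotDivW-*ₚ dW d′W))

module Division where
  open import Data.Rational using (0ℚ; _+_; _*_; NonZero; 1/_)
  open import Data.Rational.Properties
    using (*-assoc; *-identityʳ; *-inverseˡ; *-inverseʳ; pos*pos⇒pos; pos+pos⇒pos; 1/pos⇒pos)
  open import Data.Rational.Base using (≢-nonZero)
  open import Relation.Nullary using (yes; no; contradiction)

  positive⇒≢0 : ∀ {p} → Positive p → p ≢ 0ℚ
  positive⇒≢0 () refl

  *-cancelʳ-≢0 : ∀ {p q} r → r ≢ 0ℚ → p * r ≡ q * r → p ≡ q
  *-cancelʳ-≢0 {p} {q} r r≢0 pr≡qr = begin
    p                ≡⟨ undo p ⟨
    p * r * (1/ r)   ≡⟨ cong (_* 1/ r) pr≡qr ⟩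
    q * r * (1/ r)   ≡⟨ undo q ⟩
    q                ∎
    where
    instance r≠0 : NonZero r
    r≠0 = ≢-nonZero r≢0
    undo : ∀ s → s * r * (1/ r) ≡ s
    undo s = trans (*-assoc s r (1/ r)) (trans (cong (s *_) (*-inverseʳ r)) (*-identityʳ s))

  ⊘-*-cancelʳ : ∀ p q → q ≢ 0ℚ → (p ⊘ q) * q ≡ p
  ⊘-*-cancelʳ p q q≢0 with q ≟ 0ℚ
  ... | yes q≡0 = contradiction q≡0 q≢0
  ... | no  q≢0′ = trans (*-assoc p (1/ q) q) (trans (cong (p *_) (*-inverseˡ q)) (*-identityʳ p))
    where instance q≠0 : NonZero q
                   q≠0 = ≢-nonZero q≢0′

  ⊘-positive : ∀ p q → Positive p → Positive q → Positive (p ⊘ q)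
  ⊘-positive p q p>0 q>0 with q ≟ 0ℚ
  ... | yes q≡0 = contradiction q≡0 (positive⇒≢0 q>0)
  ... | no  _ = pos*pos⇒pos p {{p>0}} _ {{1/pos⇒pos q {{q>0}}}}

  sq+sq-positive : ∀ a b → Positive a → Positive b → Positive (sq a + sq b)
  sq+sq-positive a b a>0 b>0 =
    pos+pos⇒pos (sq a) {{pos*pos⇒pos a {{a>0}} a {{a>0}}}} (sq b) {{pos*pos⇒pos b {{b>0}} b {{b>0}}}}

module Cohn (t σ : ℚ) where
  open import Data.Rational using (0ℚ; _+_; _*_; _-_)
  open import Data.Rational.Properties using (*-comm; +-comm)
  open import Data.List using (_∷_; [])
  open import Tactic.RingSolver using (solve)
  open Matrix
  open Division
  open SternBrocot using (stepPair; descendPair)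

  record Markov (l c r : ℚ) : Set where
    constructor mkMarkov
    field equation : t * (l * l + c * c + r * r) ≡ σ * (l * c * r)

  Markov-reverse : ∀ {l c r} → Markov l c r → Markov r c l
  Markov-reverse {l} {c} {r} (mkMarkov equation) = mkMarkov (begin
    t * (r * r + c * c + l * l) ≡⟨ solve (t ∷ l ∷ c ∷ r ∷ []) ℚ-ring ⟩
    t * (l * l + c * c + r * r) ≡⟨ equation ⟩
    σ * (l * c * r)             ≡⟨ solve (σ ∷ l ∷ c ∷ r ∷ []) ℚ-ring ⟩
    σ * (r * c * l)             ∎)

  vieta-sum : ∀ {l c r} c′ → r ≢ 0ℚ → c′ * r ≡ l * l + c * c → Markov l c r → t * (c′ + r) ≡ σ * (l * c)
  vieta-sum {l} {c} {r} c′ r≢0 c′r≡ (mkMarkov equation) = *-cancelʳ-≢0 r r≢0 (begin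
    t * (c′ + r) * r                ≡⟨ solve (t ∷ c′ ∷ r ∷ []) ℚ-ring ⟩
    t * (c′ * r + r * r)            ≡⟨ cong (λ q → t * (q + r * r)) c′r≡ ⟩
    t * (l * l + c * c + r * r)     ≡⟨ equation ⟩
    σ * (l * c * r)                 ≡⟨ solve (σ ∷ l ∷ c ∷ r ∷ []) ℚ-ring ⟩
    σ * (l * c) * r                 ∎)

  Markov-vieta : ∀ {l c r} c′ → r ≢ 0ℚ → c′ * r ≡ l * l + c * c → Markov l c r → Markov l c′ c
  Markov-vieta {l} {c} {r} c′ r≢0 c′r≡ m = mkMarkov (begin
    t * (l * l + c′ * c′ + c * c)   ≡⟨ solve (t ∷ l ∷ c ∷ c′ ∷ []) ℚ-ring ⟩
    t * (l * l + c * c + c′ * c′)   ≡⟨ cong (λ q → t * (q + c′ * c′)) c′r≡ ⟨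
    t * (c′ * r + c′ * c′)          ≡⟨ solve (t ∷ c′ ∷ r ∷ []) ℚ-ring ⟩
    c′ * (t * (c′ + r))             ≡⟨ cong (c′ *_) (vieta-sum c′ r≢0 c′r≡ m) ⟩
    c′ * (σ * (l * c))              ≡⟨ solve (σ ∷ l ∷ c ∷ c′ ∷ []) ℚ-ring ⟩
    σ * (l * c′ * c)                ∎)

  record CohnMatrix (m s : ℚ) (E : Mat₂ ℚ) : Set where
    constructor mkCohnMatrix
    field
      value       : m * s ≡ t * m₂₁ E
      trace       : tr E ≡ σ * m₂₁ E
      determinant : det E ≡ s * s

  vieta-value : ∀ {e c o c′ sₑ s꜀ sₒ E₂₁ C₂₁ O₂₁} → t ≢ 0ℚ → s꜀ ≡ sₑ * sₒ →
    e * sₑ ≡ t * E₂₁ → c * s꜀ ≡ t * C₂₁ → o * sₒ ≡ t * O₂₁ → t * (c′ + o) ≡ σ * (e * c) →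
    c′ * (sₑ * s꜀) ≡ t * (σ * E₂₁ * C₂₁ - sₑ * sₑ * O₂₁)
  vieta-value {e} {c} {o} {c′} {sₑ} {_} {sₒ} {E₂₁} {C₂₁} {O₂₁} t≢0 refl e-value c-value o-value sum≡ =
    *-cancelʳ-≢0 t t≢0 (begin
      c′ * (sₑ * (sₑ * sₒ)) * t
        ≡⟨ solve (t ∷ c′ ∷ o ∷ sₑ ∷ sₒ ∷ []) ℚ-ring ⟩
      t * (c′ + o) * (sₑ * (sₑ * sₒ)) - sₑ * sₑ * t * (o * sₒ)
        ≡⟨ cong₂ (λ p q → p * (sₑ * (sₑ * sₒ)) - sₑ * sₑ * t * q) sum≡ o-value ⟩
      σ * (e * c) * (sₑ * (sₑ * sₒ)) - sₑ * sₑ * t * (t * O₂₁)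
        ≡⟨ solve (σ ∷ t ∷ e ∷ c ∷ sₑ ∷ sₒ ∷ O₂₁ ∷ []) ℚ-ring ⟩
      σ * (e * sₑ) * (c * (sₑ * sₒ)) - sₑ * sₑ * t * (t * O₂₁)
        ≡⟨ cong₂ (λ p q → σ * p * q - sₑ * sₑ * t * (t * O₂₁)) e-value c-value ⟩
      σ * (t * E₂₁) * (t * C₂₁) - sₑ * sₑ * t * (t * O₂₁)
        ≡⟨ solve (σ ∷ t ∷ sₑ ∷ E₂₁ ∷ C₂₁ ∷ O₂₁ ∷ []) ℚ-ring ⟩
      t * (σ * E₂₁ * C₂₁ - sₑ * sₑ * O₂₁) * t ∎)

  CohnMatrix-vieta : ∀ {e c o c′ sₑ s꜀ sₒ E C O N} → t ≢ 0ℚ → s꜀ ≡ sₑ * sₒ →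
    CohnMatrix e sₑ E → CohnMatrix c s꜀ C → CohnMatrix o sₒ O → t * (c′ + o) ≡ σ * (e * c) →
    m₂₁ N ≡ tr E * m₂₁ C - det E * m₂₁ O → tr N ≡ tr E * tr C - det E * tr O → det N ≡ det E * det C →
    CohnMatrix c′ (sₑ * s꜀) N
  CohnMatrix-vieta {e} {c} {o} {c′} {sₑ} {s꜀} {sₒ} {E} {C} {O} {N}
                   t≢0 s꜀≡ cohnₑ cohn꜀ cohnₒ sum≡ m₂₁-N tr-N det-N =
    mkCohnMatrix
      (trans (vieta-value {e} {c} {o} {c′} {sₑ} {s꜀} {sₒ} {m₂₁ E} {m₂₁ C} {m₂₁ O}
                t≢0 s꜀≡ (value cohnₑ) (value cohn꜀) (value cohnₒ) sum≡)
             (cong (t *_) (sym N₂₁≡)))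
      (begin
        tr N
          ≡⟨ tr-N ⟩
        tr E * tr C - det E * tr O
          ≡⟨ cong₂ (λ p q → p * tr C - q * tr O) (trace cohnₑ) (determinant cohnₑ) ⟩
        σ * m₂₁ E * tr C - sₑ * sₑ * tr O
          ≡⟨ cong₂ (λ p q → σ * m₂₁ E * p - sₑ * sₑ * q) (trace cohn꜀) (trace cohnₒ) ⟩
        σ * m₂₁ E * (σ * m₂₁ C) - sₑ * sₑ * (σ * m₂₁ O)
          ≡⟨ factor-σ (m₂₁ E) (m₂₁ C) (m₂₁ O) ⟩
        σ * (σ * m₂₁ E * m₂₁ C - sₑ * sₑ * m₂₁ O)
          ≡⟨ cong (σ *_) N₂₁≡ ⟨
        σ * m₂₁ N ∎)
      (begin
        det N                                   ≡⟨ det-N ⟩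
        det E * det C                           ≡⟨ cong₂ _*_ (determinant cohnₑ) (determinant cohn꜀) ⟩
        sₑ * sₑ * (s꜀ * s꜀)                     ≡⟨ solve (sₑ ∷ s꜀ ∷ []) ℚ-ring ⟩
        sₑ * s꜀ * (sₑ * s꜀)                     ∎)
    where
    open CohnMatrix
    N₂₁≡ : m₂₁ N ≡ σ * m₂₁ E * m₂₁ C - sₑ * sₑ * m₂₁ O
    N₂₁≡ = trans m₂₁-N (cong₂ (λ p q → p * m₂₁ C - q * m₂₁ O) (trace cohnₑ) (determinant cohnₑ))
    factor-σ : ∀ a b c → σ * a * (σ * b) - sₑ * sₑ * (σ * c) ≡ σ * (σ * a * b - sₑ * sₑ * c)
    factor-σ a b c = solve (σ ∷ sₑ ∷ a ∷ b ∷ c ∷ []) ℚ-ring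

  record Invariant (n : Node) (E : Mat₂ ℚ × Mat₂ ℚ) (s : ℚ × ℚ) : Set where
    constructor mkInvariant
    field
      positiveˡ : Positive (Node.left n)
      positiveᵐ : Positive (Node.mid n)
      positiveʳ : Positive (Node.right n)
      cohnˡ     : CohnMatrix (Node.left n) (proj₁ s) (proj₁ E)
      cohnᵐ     : CohnMatrix (Node.mid n) (uncurry _*_ s) (uncurry _*ₘ_ E)
      cohnʳ     : CohnMatrix (Node.right n) (proj₂ s) (proj₂ E)
      markovᵐ   : Markov (Node.left n) (Node.mid n) (Node.right n)

  step-invariant : t ≢ 0ℚ → ∀ d {n E s} → Invariant n E s →
                   Invariant (step d n) (stepPair _*ₘ_ d E) (stepPair _*_ d s)
  step-invariant t≢0 false {node l c r} {L , R} {sL , sR} (mkInvariant l>0 c>0 r>0 cohnˡ cohnᵐ cohnʳ m) =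
    mkInvariant l>0 c′>0 c>0 cohnˡ cohn′ cohnᵐ (Markov-vieta c′ r≢0 c′r≡ m)
    where
    r≢0 = positive⇒≢0 r>0
    c′ : ℚ
    c′ = (sq l + sq c) ⊘ r
    c′>0 : Positive c′
    c′>0 = ⊘-positive (sq l + sq c) r (sq+sq-positive l c l>0 c>0) r>0
    c′r≡ : c′ * r ≡ l * l + c * c
    c′r≡ = ⊘-*-cancelʳ (sq l + sq c) r r≢0
    cohn′ : CohnMatrix c′ (sL * (sL * sR)) (L *ₘ (L *ₘ R))
    cohn′ = CohnMatrix-vieta t≢0 refl cohnˡ cohnᵐ cohnʳ (vieta-sum c′ r≢0 c′r≡ m)
              (m₂₁-cayley-hamiltonˡ L R) (tr-cayley-hamiltonˡ L R) (det-*ₘ L (L *ₘ R))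
  step-invariant t≢0 true {node l c r} {L , R} {sL , sR} (mkInvariant l>0 c>0 r>0 cohnˡ cohnᵐ cohnʳ m) =
    mkInvariant c>0 c′>0 r>0 cohnᵐ cohn′ cohnʳ (Markov-reverse (Markov-vieta c′ l≢0 c′l≡ (Markov-reverse m)))
    where
    l≢0 = positive⇒≢0 l>0
    c′ : ℚ
    c′ = (sq c + sq r) ⊘ l
    c′>0 : Positive c′
    c′>0 = ⊘-positive (sq c + sq r) l (sq+sq-positive c r c>0 r>0) l>0
    c′l≡ : c′ * l ≡ r * r + c * c
    c′l≡ = trans (⊘-*-cancelʳ (sq c + sq r) l l≢0) (+-comm (sq c) (sq r))
    cohn′ : CohnMatrix c′ (sL * sR * sR) (L *ₘ R *ₘ R)
    cohn′ = subst (λ s → CohnMatrix c′ s (L *ₘ R *ₘ R)) (*-comm sR (sL * sR))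
              (CohnMatrix-vieta t≢0 (*-comm sL sR) cohnʳ cohnᵐ cohnˡ (vieta-sum c′ l≢0 c′l≡ (Markov-reverse m))
                (m₂₁-cayley-hamiltonʳ L R) (tr-cayley-hamiltonʳ L R)
                (trans (det-*ₘ (L *ₘ R) R) (*-comm (det (L *ₘ R)) (det R))))

  descend-invariant : t ≢ 0ℚ → ∀ ds {n E s} → Invariant n E s →
                      Invariant (descend ds n) (descendPair _*ₘ_ ds E) (descendPair _*_ ds s)
  descend-invariant t≢0 []       inv = inv
  descend-invariant t≢0 (d ∷ ds) inv = descend-invariant t≢0 ds (step-invariant t≢0 d inv)

module MarkovPolynomial where
  open import Data.Nat as ℕ using (ℕ)
  open import Data.Nat.Properties using (+-commutativeSemigroup; 1+n≢0)
  open import Algebra.Properties.CommutativeSemigroup +-commutativeSemigroup using (interchange)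
  open import Data.Rational using (1ℚ; _+_; _*_)
  open import Data.List using (_++_)
  open import Data.List.Relation.Unary.All using ([]; _∷_)
  open import Data.List.Relation.Unary.Any using (here)
  open SternBrocot
  open Polynomial
  open Matrix

  E₀ E₁ : Mat₂ Poly
  E₀ = mat (𝐮 ++ 𝐰) (𝐮 *ₚ 𝐯) 𝟏 𝐯
  E₁ = mat 𝐮 (𝐮 *ₚ 𝐯) 𝟏 (𝐯 ++ 𝐰)

  module _ (u v w : ℚ) where

    evalMat-E₀ : evalMat u v w E₀ ≡ mat (u + w) (u * v) 1ℚ v
    evalMat-E₀ = mat-cong (trans (evalPoly-++ u v w 𝐮 𝐰) (cong₂ _+_ (evalPoly-𝐮 u v w) (evalPoly-𝐰 u v w)))
                          (trans (evalPoly-*ₚ u v w 𝐮 𝐯) (cong₂ _*_ (evalPoly-𝐮 u v w) (evalPoly-𝐯 u v w)))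
                          refl
                          (evalPoly-𝐯 u v w)

    evalMat-E₁ : evalMat u v w E₁ ≡ mat u (u * v) 1ℚ (v + w)
    evalMat-E₁ = mat-cong (evalPoly-𝐮 u v w)
                          (trans (evalPoly-*ₚ u v w 𝐮 𝐯) (cong₂ _*_ (evalPoly-𝐮 u v w) (evalPoly-𝐯 u v w)))
                          refl
                          (trans (evalPoly-++ u v w 𝐯 𝐰) (cong₂ _+_ (evalPoly-𝐯 u v w) (evalPoly-𝐰 u v w)))

  weight : Fraction → ℕ
  weight (p , q) = p ℕ.+ q

  weight-⊕ : ∀ f g → weight f ℕ.+ weight g ≡ weight (f ⊕ g)
  weight-⊕ (p , q) (r , s) = interchange p q r s

  record PolynomialCohnMatrix (f : Fraction) (E : Mat₂ Poly) : Set where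
    constructor mkPolynomialCohnMatrix
    field
      homogeneous : HomogeneousMat (weight f) E
      indivisible : Indivisible E

  PolynomialCohnMatrix-*ₚₘ : ∀ {f g E F} → PolynomialCohnMatrix f E → PolynomialCohnMatrix g F →
                             PolynomialCohnMatrix (f ⊕ g) (E *ₚₘ F)
  PolynomialCohnMatrix-*ₚₘ {f} {g} {E} {F} (mkPolynomialCohnMatrix homE indE) (mkPolynomialCohnMatrix homF indF) =
    mkPolynomialCohnMatrix
      (subst (λ n → HomogeneousMat n (E *ₚₘ F)) (weight-⊕ f g) (HomogeneousMat-*ₚₘ {E = E} {F} homE homF))
      (Indivisible-*ₚₘ {E} {F} indE indF)

  fractionAt : List Bool → Fraction
  fractionAt ds = mediant _⊕_ ds ((0 , 1) , (1 , 0))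

  cohnMatrixAt : List Bool → Mat₂ Poly
  cohnMatrixAt ds = mediant _*ₚₘ_ ds (E₀ , E₁)

  cohnMatrixAt-PolynomialCohnMatrix : ∀ ds → PolynomialCohnMatrix (fractionAt ds) (cohnMatrixAt ds)
  cohnMatrixAt-PolynomialCohnMatrix ds =
    mediant-related _⊕_ _*ₚₘ_ PolynomialCohnMatrix PolynomialCohnMatrix-*ₚₘ ds (E₀-cohn , E₁-cohn)
    where
    E₀-cohn : PolynomialCohnMatrix (0 , 1) E₀
    E₀-cohn = mkPolynomialCohnMatrix
      (refl ∷ refl ∷ [] , refl ∷ [] , refl ∷ [] , refl ∷ [])
      ((here (1+n≢0 , refl) , here (1+n≢0 , refl)) ,
       (here (1+n≢0 , refl) , here (1+n≢0 , refl)) ,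
       (here (1+n≢0 , refl) , here (1+n≢0 , refl) , here (1+n≢0 , refl)))
    E₁-cohn : PolynomialCohnMatrix (1 , 0) E₁
    E₁-cohn = mkPolynomialCohnMatrix
      (refl ∷ [] , refl ∷ [] , refl ∷ [] , refl ∷ refl ∷ [])
      ((here (1+n≢0 , refl) , here (1+n≢0 , refl)) ,
       (here (1+n≢0 , refl) , here (1+n≢0 , refl)) ,
       (here (1+n≢0 , refl) , here (1+n≢0 , refl) , here (1+n≢0 , refl)))

  markovPolynomial : List Bool → Poly
  markovPolynomial ds = m₂₁ (cohnMatrixAt ds)

  markovPolynomial-homogeneous : ∀ ds → Homogeneous (weight (fractionAt ds) ℕ.∸ 1) (markovPolynomial ds)
  markovPolynomial-homogeneous ds with PolynomialCohnMatrix.homogeneous (cohnMatrixAt-PolynomialCohnMatrix ds)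
  ... | _ , _ , m₂₁-homogeneous , _ = HomogeneousEntry⇒Homogeneous m₂₁-homogeneous

  markovPolynomial-indivisible : ∀ ds → let P = markovPolynomial ds in NotDivU P × NotDivV P × NotDivW P
  markovPolynomial-indivisible ds with PolynomialCohnMatrix.indivisible (cohnMatrixAt-PolynomialCohnMatrix ds)
  ... | (notDivU , _) , (_ , notDivV) , (_ , notDivW , _) = notDivU , notDivV , notDivW

module Evaluation (x y z : ℚ) (x>0 : Positive x) (y>0 : Positive y) (z>0 : Positive z) where
  open import Data.Nat as ℕ using (suc)
  open import Data.Rational using (0ℚ; 1ℚ; _+_; _*_; _-_)
  open import Data.Rational.Properties using (*-comm; pos*pos⇒pos)
  open import Tactic.RingSolver using (solve)
  open SternBrocot
  open Polynomial
  open Matrix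
  open Division
  open MarkovPolynomial
  open Cohn (x * (y * z)) (x * x + y * y + z * z)

  monomial : Fraction → Term
  monomial (p , q) = term 1 p q (p ℕ.+ q)

  scale : Fraction → ℚ
  scale f = evalTerm (monomial f) x y z

  scale-⊕ : ∀ f g → scale (f ⊕ g) ≡ scale f * scale g
  scale-⊕ f@(p , q) g@(r , s) = begin
    evalTerm (monomial (f ⊕ g)) x y z
      ≡⟨ cong (λ n → evalTerm (term 1 (p ℕ.+ r) (q ℕ.+ s) n) x y z) (weight-⊕ f g) ⟨
    evalTerm (monomial f ·ₜ monomial g) x y z
      ≡⟨ evalTerm-·ₜ x y z (monomial f) (monomial g) ⟩
    scale f * scale g ∎

  A₀ B₀ : Mat₂ ℚ
  A₀ = mat (x * x + z * z) (x * x * (y * y)) 1ℚ (y * y)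
  B₀ = mat (x * x) (x * x * (y * y)) 1ℚ (y * y + z * z)

  scale-0/1 : scale (0 , 1) ≡ y * z
  scale-0/1 = begin
    scale (0 , 1)                     ≡⟨⟩
    1ℚ * (1ℚ * (y * 1ℚ * (z * 1ℚ)))   ≡⟨ solve (y ∷ z ∷ []) ℚ-ring ⟩
    y * z                             ∎

  scale-1/0 : scale (1 , 0) ≡ x * z
  scale-1/0 = begin
    scale (1 , 0)                     ≡⟨⟩
    1ℚ * (x * 1ℚ * (1ℚ * (z * 1ℚ)))   ≡⟨ solve (x ∷ z ∷ []) ℚ-ring ⟩
    x * z                             ∎

  t≢0 : x * (y * z) ≢ 0ℚ
  t≢0 = positive⇒≢0 (pos*pos⇒pos x {{x>0}} (y * z) {{pos*pos⇒pos y {{y>0}} z {{z>0}}}})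

  c₀ : ℚ
  c₀ = (sq x + sq y) ⊘ z

  c₀z≡ : c₀ * z ≡ x * x + y * y
  c₀z≡ = ⊘-*-cancelʳ (sq x + sq y) z (positive⇒≢0 z>0)

  A₀-cohn : CohnMatrix x (y * z) A₀
  A₀-cohn = mkCohnMatrix value trace determinant
    where
    value : x * (y * z) ≡ x * (y * z) * 1ℚ
    value = solve (x ∷ y ∷ z ∷ []) ℚ-ring
    trace : x * x + z * z + y * y ≡ (x * x + y * y + z * z) * 1ℚ
    trace = solve (x ∷ y ∷ z ∷ []) ℚ-ring
    determinant : (x * x + z * z) * (y * y) - x * x * (y * y) * 1ℚ ≡ y * z * (y * z)
    determinant = solve (x ∷ y ∷ z ∷ []) ℚ-ring

  B₀-cohn : CohnMatrix y (x * z) B₀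
  B₀-cohn = mkCohnMatrix value trace determinant
    where
    value : y * (x * z) ≡ x * (y * z) * 1ℚ
    value = solve (x ∷ y ∷ z ∷ []) ℚ-ring
    trace : x * x + (y * y + z * z) ≡ (x * x + y * y + z * z) * 1ℚ
    trace = solve (x ∷ y ∷ z ∷ []) ℚ-ring
    determinant : x * x * (y * y + z * z) - x * x * (y * y) * 1ℚ ≡ x * z * (x * z)
    determinant = solve (x ∷ y ∷ z ∷ []) ℚ-ring

  A₀B₀-cohn : CohnMatrix c₀ (y * z * (x * z)) (A₀ *ₘ B₀)
  A₀B₀-cohn = mkCohnMatrix (value c₀ c₀z≡) trace determinant
    where
    value : ∀ c → c * z ≡ x * x + y * y → c * (y * z * (x * z)) ≡ x * (y * z) * (1ℚ * (x * x) + y * y * 1ℚ)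
    value c cz≡ = begin
      c * (y * z * (x * z))                        ≡⟨ solve (x ∷ y ∷ z ∷ c ∷ []) ℚ-ring ⟩
      c * z * (x * (y * z))                        ≡⟨ cong (_* (x * (y * z))) cz≡ ⟩
      (x * x + y * y) * (x * (y * z))              ≡⟨ solve (x ∷ y ∷ z ∷ []) ℚ-ring ⟩
      x * (y * z) * (1ℚ * (x * x) + y * y * 1ℚ)    ∎
    trace : (x * x + z * z) * (x * x) + x * x * (y * y) * 1ℚ + (1ℚ * (x * x * (y * y)) + y * y * (y * y + z * z))
            ≡ (x * x + y * y + z * z) * (1ℚ * (x * x) + y * y * 1ℚ)
    trace = solve (x ∷ y ∷ z ∷ []) ℚ-ring
    determinant : det (A₀ *ₘ B₀) ≡ y * z * (x * z) * (y * z * (x * z))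
    determinant = begin
      det (A₀ *ₘ B₀)
        ≡⟨ det-*ₘ A₀ B₀ ⟩
      det A₀ * det B₀
        ≡⟨ cong₂ _*_ (CohnMatrix.determinant A₀-cohn) (CohnMatrix.determinant B₀-cohn) ⟩
      y * z * (y * z) * (x * z * (x * z))
        ≡⟨ solve (x ∷ y ∷ z ∷ []) ℚ-ring ⟩
      y * z * (x * z) * (y * z * (x * z)) ∎

  root-invariant : Invariant (root x y z) (A₀ , B₀) (y * z , x * z)
  root-invariant =
    mkInvariant x>0 (⊘-positive (sq x + sq y) z (sq+sq-positive x y x>0 y>0) z>0) y>0
              A₀-cohn A₀B₀-cohn B₀-cohn (Markov-vieta c₀ (positive⇒≢0 z>0) c₀z≡ xyz-markov)
    where
    xyz-markov : Markov x y z
    xyz-markov = mkMarkov (solve (x ∷ y ∷ z ∷ []) ℚ-ring)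

  markovPolynomial-value : ∀ ds → Node.mid (descend ds (root x y z)) * scale (fractionAt ds)
                                  ≡ x * (y * z) * evalPoly (markovPolynomial ds) (x * x) (y * y) (z * z)
  markovPolynomial-value ds = begin
    Node.mid (descend ds (root x y z)) * scale (fractionAt ds)
      ≡⟨ cong (Node.mid (descend ds (root x y z)) *_) scales ⟩
    Node.mid (descend ds (root x y z)) * mediant _*_ ds (y * z , x * z)
      ≡⟨ CohnMatrix.value (Invariant.cohnᵐ (descend-invariant t≢0 ds root-invariant)) ⟩
    x * (y * z) * m₂₁ (mediant _*ₘ_ ds (A₀ , B₀))
      ≡⟨ cong (λ E → x * (y * z) * m₂₁ E) matrices ⟨
    x * (y * z) * evalPoly (markovPolynomial ds) (x * x) (y * y) (z * z) ∎
    where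
    scales : scale (fractionAt ds) ≡ mediant _*_ ds (y * z , x * z)
    scales = mediant-related _⊕_ _*_ (λ f s → scale f ≡ s)
               (λ {f} {g} f≡ g≡ → trans (scale-⊕ f g) (cong₂ _*_ f≡ g≡))
               ds {(0 , 1) , (1 , 0)} (scale-0/1 , scale-1/0)
    matrices : evalMat (x * x) (y * y) (z * z) (cohnMatrixAt ds) ≡ mediant _*ₘ_ ds (A₀ , B₀)
    matrices = mediant-related _*ₚₘ_ _*ₘ_ (λ E M → evalMat (x * x) (y * y) (z * z) E ≡ M)
                 (λ {E} {F} E≡ F≡ → trans (evalMat-*ₚₘ (x * x) (y * y) (z * z) E F) (cong₂ _*ₘ_ E≡ F≡))
                 ds {E₀ , E₁} (evalMat-E₀ (x * x) (y * y) (z * z) , evalMat-E₁ (x * x) (y * y) (z * z))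

  markovPolynomial-identity : ∀ ds {a b} → fractionAt ds ≡ (suc a , suc b) →
    Node.mid (descend ds (root x y z)) * (x ^ℚ a * (y ^ℚ b * z ^ℚ (a ℕ.+ suc b)))
      ≡ evalPoly (markovPolynomial ds) (x * x) (y * y) (z * z)
  markovPolynomial-identity ds {a} {b} fraction≡ = *-cancelʳ-≢0 (x * (y * z)) t≢0 (begin
    m * (x ^ℚ a * (y ^ℚ b * z ^ℚ (a ℕ.+ suc b))) * (x * (y * z))
      ≡⟨ redistribute m (x ^ℚ a) (y ^ℚ b) (z ^ℚ (a ℕ.+ suc b)) ⟩
    m * scale (suc a , suc b)
      ≡⟨ cong (λ f → m * scale f) fraction≡ ⟨
    m * scale (fractionAt ds)
      ≡⟨ markovPolynomial-value ds ⟩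
    x * (y * z) * P
      ≡⟨ *-comm (x * (y * z)) P ⟩
    P * (x * (y * z)) ∎)
    where
    m = Node.mid (descend ds (root x y z))
    P = evalPoly (markovPolynomial ds) (x * x) (y * y) (z * z)
    redistribute : ∀ c X Y Z → c * (X * (Y * Z)) * (x * (y * z)) ≡ c * (1ℚ * (x * X * (y * Y * (z * Z))))
    redistribute c X Y Z = solve (c ∷ X ∷ Y ∷ Z ∷ x ∷ y ∷ z ∷ []) ℚ-ring

open import Data.Nat using (ℕ; _≤_; _∸_; _+_; suc; s≤s; z≤n)
open import Data.Nat.Coprimality using (Coprime)
open import Data.Product using (Σ)
open import Data.Rational using (_*_)
open SternBrocot using (sbPath-mediant-⊕)
open MarkovPolynomial using (weight; fractionAt; markovPolynomial; markovPolynomial-homogeneous; markovPolynomial-indivisible)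

theorem3p1 : (a b : ℕ) → 1 ≤ a → 1 ≤ b → Coprime a b →
    Σ Poly (λ P →
      Homogeneous (a + b ∸ 1) P × NotDivU P × NotDivV P × NotDivW P ×
      ((x y z : ℚ) → Positive x → Positive y → Positive z →
        M a b x y z * ((x ^ℚ (a ∸ 1)) * ((y ^ℚ (b ∸ 1)) * (z ^ℚ (a + b ∸ 1))))
          ≡ evalPoly P (sq x) (sq y) (sq z)))
theorem3p1 (suc a) (suc b) (s≤s z≤n) (s≤s z≤n) coprime =
  let notDivU , notDivV , notDivW = markovPolynomial-indivisible path in
  markovPolynomial path , homogeneous , notDivU , notDivV , notDivW ,
  λ x y z x>0 y>0 z>0 → Evaluation.markovPolynomial-identity x y z x>0 y>0 z>0 path fraction≡
  where
  path = sbPath (suc a + suc b) (suc a) (suc b)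
  fraction≡ : fractionAt path ≡ (suc a , suc b)
  fraction≡ = sbPath-mediant-⊕ (s≤s z≤n) (s≤s z≤n) coprime
  homogeneous : Homogeneous (suc a + suc b ∸ 1) (markovPolynomial path)
  homogeneous = subst (λ f → Homogeneous (weight f ∸ 1) (markovPolynomial path)) fraction≡
                      (markovPolynomial-homogeneous path)
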